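{- Let $n\geqslant 1$ be an integer and let $(a_1,\ldots,a_{n+1})$ and $(b_1,\ldots,b_n)$ be two sequences of positive integers such that: (1) $a_1$ and $a_{n+1}$ are odd, while $a_2,\ldots,a_n$ are even; (2) for every $I\subseteq[n]=\{1,\dots,n\}$ we have $\sum_{i\in I}b_i\neq \sum_{i\notin I}b_i$. Then the binary word $$W=\mathtt{1}^{a_1}\mathtt{0}^{b_1}\mathtt{1}^{a_2}\mathtt{0}^{b_2}\mathtt{1}^{a_3}\cdots\mathtt{1}^{a_n}\mathtt{0}^{b_n}\mathtt{1}^{a_{n+1}}$$ is not a shuffle square.
   Context: A word is a finite sequence of letters; $w^r$ denotes $r$ consecutive copies of the letter $w$, and concatenation is juxtaposition. A subword of $W=w_1\cdots w_N$ is a subsequence $w_{i_1}\cdots w_{i_t}$ ($i_1<\dots<i_t$), with support $\{i_1,\dots,i_t\}$. A word $W$ is a shuffle square if its positions can be partitioned into the supports of two subwords $X$ and $Y$ that are equal as words (i.e. $W$ consists of two shuffled copies of the same word). -}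

module Defs where

open import Data.Bool using (Bool; true; false; not)
open import Data.Nat using (ℕ; zero; suc; _+_)
open import Data.List using (List; []; _∷_; _++_; replicate; length)
open import Data.Fin using (Fin; zero; suc)
open import Data.Product using (Σ; _×_; _,_)
open import Relation.Binary.PropositionalEquality using (_≡_)

-- Letters of a binary word: true = 1, false = 0.
Word : Set
Word = List Bool

subwordOf : {A : Set} → List Bool → List A → Bool → List A
subwordOf []      _        _ = []
subwordOf (_ ∷ _) []       _ = []
subwordOf (l ∷ ls) (x ∷ xs) b with l | b
... | true  | true  = x ∷ subwordOf ls xs b
... | false | false = x ∷ subwordOf ls xs b
... | true  | false = subwordOf ls xs b
... | false | true  = subwordOf ls xs b

-- W is a shuffle square iff its positions can be partitioned into the
-- supports of two subwords X and Y with X = Y.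
IsShuffleSquare : {A : Set} → List A → Set
IsShuffleSquare {A} w =
  Σ (List Bool) λ l → (length l ≡ length w) × (subwordOf l w true ≡ subwordOf l w false)

-- The word 1^{a_1} 0^{b_1} 1^{a_2} 0^{b_2} ... 1^{a_n} 0^{b_n} 1^{a_{n+1}},
-- with a : Fin (n+1) → ℕ (a_1 = a zero) and b : Fin n → ℕ (b_1 = b zero).
blockTail : (n : ℕ) → (Fin n → ℕ) → (Fin n → ℕ) → Word
blockTail zero    a' b = []
blockTail (suc n) a' b =
  replicate (b zero) false ++ replicate (a' zero) true ++ blockTail n (λ i → a' (suc i)) (λ i → b (suc i))

blockWord : (n : ℕ) → (Fin (suc n) → ℕ) → (Fin n → ℕ) → Word
blockWord n a b = replicate (a zero) true ++ blockTail n (λ i → a (suc i)) b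

sumWhere : (n : ℕ) → (Fin n → Bool) → Bool → (Fin n → ℕ) → ℕ
sumWhere zero    I c b = 0
sumWhere (suc n) I c b with I zero | c
... | true  | true  = b zero + sumWhere n (λ i → I (suc i)) c (λ i → b (suc i))
... | false | false = b zero + sumWhere n (λ i → I (suc i)) c (λ i → b (suc i))
... | true  | false = sumWhere n (λ i → I (suc i)) c (λ i → b (suc i))
... | false | true  = sumWhere n (λ i → I (suc i)) c (λ i → b (suc i))

{-# OPTIONS --safe #-}
-- Read each 0 of W together with the parity of the number of 1s preceding it
-- inside its own copy, X or Y. If X = Y, the 0s of X at even parity together
-- with the 0s of Y at odd parity are exactly the 0s of one copy, i.e. half of
-- all 0s of W. In the i-th 0-block, a_1 + ... + a_i 1s of W have been read,
-- an odd number, so the X-parity and the Y-parity differ there: either every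
-- 0 of that block is counted or none is. Hence half of b_1 + ... + b_n is a
-- subsum over some I ⊆ [n], contradicting (2).
module Submission where

open import Defs
open import Data.Bool using (Bool; true; false)
open import Data.Nat using (ℕ; zero; suc; _≤_; _<_; _+_; _*_; s≤s; z≤n; parity)
open import Data.Nat.Properties using (+-comm; +-assoc; +-suc; +-cancelˡ-≡; suc-injective; +-commutativeSemigroup)
open import Algebra.Properties.CommutativeSemigroup +-commutativeSemigroup using (x∙yz≈y∙xz)
open import Data.Nat.Divisibility using (_∣_; divides)
open import Data.Parity.Base as ℙ using (Parity; 0ℙ; 1ℙ; _⁻¹)
import Data.Parity.Properties as ℙₚ
import Algebra.Properties.CommutativeSemigroup ℙₚ.+-commutativeSemigroup as ℙₛ
open import Data.Fin using (Fin; zero; suc; toℕ; fromℕ)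
open import Data.List using (List; []; _∷_; _++_; replicate; length; drop)
open import Data.Vec.Functional as Vector using (foldr)
open import Data.Product using (_×_; _,_; ∃; ∃₂)
open import Function using (_∘_)
open import Relation.Binary.PropositionalEquality
  using (_≡_; _≢_; refl; sym; trans; cong; cong₂; module ≡-Reasoning)
open import Relation.Nullary using (¬_; contradiction)

open ≡-Reasoning

2∣⇒parity≡0ℙ : ∀ {k} → 2 ∣ k → parity k ≡ 0ℙ
2∣⇒parity≡0ℙ (divides q refl) = parity-*2 q
  where
  parity-*2 : ∀ q → parity (q * 2) ≡ 0ℙ
  parity-*2 zero    = refl
  parity-*2 (suc q) = parity-*2 q

parity≡0ℙ⇒2∣ : ∀ k → parity k ≡ 0ℙ → 2 ∣ k
parity≡0ℙ⇒2∣ zero          _ = divides 0 refl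
parity≡0ℙ⇒2∣ (suc zero)    ()
parity≡0ℙ⇒2∣ (suc (suc k)) e with parity≡0ℙ⇒2∣ k e
... | divides q k≡q*2 = divides (suc q) (cong (2 +_) k≡q*2)

¬2∣⇒parity≡1ℙ : ∀ {k} → ¬ (2 ∣ k) → parity k ≡ 1ℙ
¬2∣⇒parity≡1ℙ {k} k-odd with parity k in eq
... | 1ℙ = refl
... | 0ℙ = contradiction (parity≡0ℙ⇒2∣ k eq) k-odd

isEven : Parity → Bool
isEven 0ℙ = true
isEven 1ℙ = false

whenEven : Parity → ℕ → ℕ
whenEven 0ℙ k = k
whenEven 1ℙ _ = 0

zeros : Word → ℕ
zeros []          = 0
zeros (true ∷ w)  = zeros w
zeros (false ∷ w) = suc (zeros w)

zerosAt : Parity → Word → ℕ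
zerosAt p []          = 0
zerosAt p (true ∷ w)  = zerosAt (p ⁻¹) w
zerosAt p (false ∷ w) = whenEven p 1 + zerosAt p w

zerosAt-0ℙ+1ℙ : ∀ w → zerosAt 0ℙ w + zerosAt 1ℙ w ≡ zeros w
zerosAt-0ℙ+1ℙ []          = refl
zerosAt-0ℙ+1ℙ (true ∷ w)  = trans (+-comm (zerosAt 1ℙ w) _) (zerosAt-0ℙ+1ℙ w)
zerosAt-0ℙ+1ℙ (false ∷ w) = cong suc (zerosAt-0ℙ+1ℙ w)

zeros-subwordOf : ∀ (l : List Bool) w → length l ≡ length w →
  zeros (subwordOf l w true) + zeros (subwordOf l w false) ≡ zeros w
zeros-subwordOf []          []          _   = refl
zeros-subwordOf (true ∷ l)  (true ∷ w)  len = zeros-subwordOf l w (suc-injective len)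
zeros-subwordOf (false ∷ l) (true ∷ w)  len = zeros-subwordOf l w (suc-injective len)
zeros-subwordOf (true ∷ l)  (false ∷ w) len = cong suc (zeros-subwordOf l w (suc-injective len))
zeros-subwordOf (false ∷ l) (false ∷ w) len =
  trans (+-suc (zeros (subwordOf l w true)) _) (cong suc (zeros-subwordOf l w (suc-injective len)))

zerosAtSplit : List Bool → Word → Parity → Parity → ℕ
zerosAtSplit []          _           _ _ = 0
zerosAtSplit (_ ∷ _)     []          _ _ = 0
zerosAtSplit (true ∷ l)  (true ∷ w)  p q = zerosAtSplit l w (p ⁻¹) q
zerosAtSplit (false ∷ l) (true ∷ w)  p q = zerosAtSplit l w p (q ⁻¹)
zerosAtSplit (true ∷ l)  (false ∷ w) p q = whenEven p 1 + zerosAtSplit l w p q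
zerosAtSplit (false ∷ l) (false ∷ w) p q = whenEven q 1 + zerosAtSplit l w p q

zerosAtSplit-[]ʳ : ∀ l p q → zerosAtSplit l [] p q ≡ 0
zerosAtSplit-[]ʳ []      _ _ = refl
zerosAtSplit-[]ʳ (_ ∷ _) _ _ = refl

zerosAtSplit-subwordOf : ∀ l w p q →
  zerosAtSplit l w p q ≡ zerosAt p (subwordOf l w true) + zerosAt q (subwordOf l w false)
zerosAtSplit-subwordOf []          _           _ _ = refl
zerosAtSplit-subwordOf (_ ∷ _)     []          _ _ = refl
zerosAtSplit-subwordOf (true ∷ l)  (true ∷ w)  p q = zerosAtSplit-subwordOf l w (p ⁻¹) q
zerosAtSplit-subwordOf (false ∷ l) (true ∷ w)  p q = zerosAtSplit-subwordOf l w p (q ⁻¹)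
zerosAtSplit-subwordOf (true ∷ l)  (false ∷ w) p q =
  trans (cong (whenEven p 1 +_) (zerosAtSplit-subwordOf l w p q)) (sym (+-assoc (whenEven p 1) _ _))
zerosAtSplit-subwordOf (false ∷ l) (false ∷ w) p q =
  trans (cong (whenEven q 1 +_) (zerosAtSplit-subwordOf l w p q))
        (x∙yz≈y∙xz (whenEven q 1) (zerosAt p (subwordOf l w true)) _)

zerosAtSplit-shuffleSquare : ∀ (l : List Bool) w → length l ≡ length w →
  subwordOf l w true ≡ subwordOf l w false →
  zerosAtSplit l w 0ℙ 1ℙ + zerosAtSplit l w 0ℙ 1ℙ ≡ zeros w
zerosAtSplit-shuffleSquare l w len X≡Y = begin
  zerosAtSplit l w 0ℙ 1ℙ + zerosAtSplit l w 0ℙ 1ℙ ≡⟨ cong₂ _+_ split≡zerosY split≡zerosY ⟩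
  zeros Y + zeros Y                               ≡⟨ cong (λ v → zeros v + zeros Y) (sym X≡Y) ⟩
  zeros X + zeros Y                               ≡⟨ zeros-subwordOf l w len ⟩
  zeros w                                         ∎
  where
  X = subwordOf l w true
  Y = subwordOf l w false
  split≡zerosY : zerosAtSplit l w 0ℙ 1ℙ ≡ zeros Y
  split≡zerosY = begin
    zerosAtSplit l w 0ℙ 1ℙ    ≡⟨ zerosAtSplit-subwordOf l w 0ℙ 1ℙ ⟩
    zerosAt 0ℙ X + zerosAt 1ℙ Y ≡⟨ cong (λ v → zerosAt 0ℙ v + zerosAt 1ℙ Y) X≡Y ⟩
    zerosAt 0ℙ Y + zerosAt 1ℙ Y ≡⟨ zerosAt-0ℙ+1ℙ Y ⟩
    zeros Y                     ∎

length-drop-replicate-++ : ∀ k {x : Bool} {r : Word} (l : List Bool) →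
  length l ≡ length (replicate k x ++ r) → length (drop k l) ≡ length r
length-drop-replicate-++ zero    l       len = len
length-drop-replicate-++ (suc k) (_ ∷ l) len = length-drop-replicate-++ k l (suc-injective len)

parity-suc-shift : ∀ k s → parity k ℙ.+ (1ℙ ℙ.+ s) ≡ parity (suc k) ℙ.+ s
parity-suc-shift k s = trans (ℙₛ.x∙yz≈yx∙z (parity k) 1ℙ s) (cong (ℙ._+ s) (sym (ℙₚ.+-homo-+ 1 k)))

zerosAtSplit-replicate-true-++ : ∀ k l r p q → ∃₂ λ p′ q′ →
  p′ ℙ.+ q′ ≡ parity k ℙ.+ (p ℙ.+ q) ×
  zerosAtSplit l (replicate k true ++ r) p q ≡ zerosAtSplit (drop k l) r p′ q′
zerosAtSplit-replicate-true-++ zero    l           r p q = p , q , refl , refl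
zerosAtSplit-replicate-true-++ (suc k) []          r p q =
  0ℙ , parity (suc k) ℙ.+ (p ℙ.+ q) , refl , refl
zerosAtSplit-replicate-true-++ (suc k) (true ∷ l)  r p q with zerosAtSplit-replicate-true-++ k l r (p ⁻¹) q
... | p′ , q′ , p′+q′≡ , eq =
  p′ , q′ , trans p′+q′≡ (trans (cong (parity k ℙ.+_) (ℙₚ.+-assoc 1ℙ p q)) (parity-suc-shift k _)) , eq
zerosAtSplit-replicate-true-++ (suc k) (false ∷ l) r p q with zerosAtSplit-replicate-true-++ k l r p (q ⁻¹)
... | p′ , q′ , p′+q′≡ , eq =
  p′ , q′ , trans p′+q′≡ (trans (cong (parity k ℙ.+_) (ℙₛ.x∙yz≈y∙xz p 1ℙ q)) (parity-suc-shift k _)) , eq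

-- Since p + q ≡ 0ℙ forces p = q, whether a 0 counts does not depend on the copy taking it.
zerosAtSplit-replicate-false-++ : ∀ k l r p q → p ℙ.+ q ≡ 0ℙ →
  length l ≡ length (replicate k false ++ r) →
  zerosAtSplit l (replicate k false ++ r) p q ≡ whenEven p k + zerosAtSplit (drop k l) r p q
zerosAtSplit-replicate-false-++ _       _           _ 0ℙ 1ℙ () _
zerosAtSplit-replicate-false-++ _       _           _ 1ℙ 0ℙ () _
zerosAtSplit-replicate-false-++ zero    _           _ 0ℙ 0ℙ _  _   = refl
zerosAtSplit-replicate-false-++ zero    _           _ 1ℙ 1ℙ _  _   = refl
zerosAtSplit-replicate-false-++ (suc k) (true ∷ l)  r 0ℙ 0ℙ _  len =
  cong suc (zerosAtSplit-replicate-false-++ k l r 0ℙ 0ℙ refl (suc-injective len))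
zerosAtSplit-replicate-false-++ (suc k) (false ∷ l) r 0ℙ 0ℙ _  len =
  cong suc (zerosAtSplit-replicate-false-++ k l r 0ℙ 0ℙ refl (suc-injective len))
zerosAtSplit-replicate-false-++ (suc k) (true ∷ l)  r 1ℙ 1ℙ _  len =
  zerosAtSplit-replicate-false-++ k l r 1ℙ 1ℙ refl (suc-injective len)
zerosAtSplit-replicate-false-++ (suc k) (false ∷ l) r 1ℙ 1ℙ _  len =
  zerosAtSplit-replicate-false-++ k l r 1ℙ 1ℙ refl (suc-injective len)

sumWhere-isEven-∷ : ∀ {m} p (I : Fin m → Bool) (b : Fin (suc m) → ℕ) →
  whenEven p (b zero) + sumWhere m I true (b ∘ suc) ≡ sumWhere (suc m) (isEven p Vector.∷ I) true b
sumWhere-isEven-∷ 0ℙ I b = refl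
sumWhere-isEven-∷ 1ℙ I b = refl

-- For n = 0 the word has no 0s and a zero = a_{n+1} is unconstrained, hence 0 < n.
zerosAtSplit-blockWord : ∀ n (a : Fin (suc n) → ℕ) (b : Fin n → ℕ) →
  (∀ (i : Fin (suc n)) → 1 ≤ toℕ i → toℕ i < n → 2 ∣ a i) →
  ∀ l p q → (0 < n → parity (a zero) ℙ.+ (p ℙ.+ q) ≡ 0ℙ) → length l ≡ length (blockWord n a b) →
  ∃ λ I → zerosAtSplit l (blockWord n a b) p q ≡ sumWhere n I true b
zerosAtSplit-blockWord zero a b _ l p q _ _ with zerosAtSplit-replicate-true-++ (a zero) l [] p q
... | p′ , q′ , _ , eq = Vector.[] , trans eq (zerosAtSplit-[]ʳ (drop (a zero) l) p′ q′)
zerosAtSplit-blockWord (suc m) a b evens l p q agree len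
  with zerosAtSplit-replicate-true-++ (a zero) l (blockTail (suc m) (a ∘ suc) b) p q
... | p′ , q′ , p′+q′≡ , eq₁ =
  let I , eq₃ = zerosAtSplit-blockWord m (a ∘ suc) (b ∘ suc) evens′ l₂ p′ q′ agree′
                  (length-drop-replicate-++ (b zero) l₁ len₁)
  in isEven p′ Vector.∷ I , (begin
    zerosAtSplit l (blockWord (suc m) a b) p q                ≡⟨ eq₁ ⟩
    zerosAtSplit l₁ (blockTail (suc m) (a ∘ suc) b) p′ q′
      ≡⟨ zerosAtSplit-replicate-false-++ (b zero) l₁ _ p′ q′ p′+q′≡0ℙ len₁ ⟩
    whenEven p′ (b zero) + zerosAtSplit l₂ rest p′ q′         ≡⟨ cong (whenEven p′ (b zero) +_) eq₃ ⟩
    whenEven p′ (b zero) + sumWhere m I true (b ∘ suc)        ≡⟨ sumWhere-isEven-∷ p′ I b ⟩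
    sumWhere (suc m) (isEven p′ Vector.∷ I) true b            ∎)
  where
  rest = blockWord m (a ∘ suc) (b ∘ suc)
  l₁ = drop (a zero) l
  l₂ = drop (b zero) l₁
  len₁ = length-drop-replicate-++ (a zero) l len
  p′+q′≡0ℙ = trans p′+q′≡ (agree (s≤s z≤n))
  evens′ : ∀ (i : Fin (suc m)) → 1 ≤ toℕ i → toℕ i < m → 2 ∣ a (suc i)
  evens′ i _ i<m = evens (suc i) (s≤s z≤n) (s≤s i<m)
  agree′ : 0 < m → parity (a (suc zero)) ℙ.+ (p′ ℙ.+ q′) ≡ 0ℙ
  agree′ 0<m =
    trans (cong (ℙ._+ (p′ ℙ.+ q′)) (2∣⇒parity≡0ℙ (evens (suc zero) (s≤s z≤n) (s≤s 0<m)))) p′+q′≡0ℙ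

zeros-replicate-true-++ : ∀ k w → zeros (replicate k true ++ w) ≡ zeros w
zeros-replicate-true-++ zero    w = refl
zeros-replicate-true-++ (suc k) w = zeros-replicate-true-++ k w

zeros-replicate-false-++ : ∀ k w → zeros (replicate k false ++ w) ≡ k + zeros w
zeros-replicate-false-++ zero    w = refl
zeros-replicate-false-++ (suc k) w = cong suc (zeros-replicate-false-++ k w)

zeros-blockWord : ∀ n (a : Fin (suc n) → ℕ) (b : Fin n → ℕ) → zeros (blockWord n a b) ≡ foldr _+_ 0 b
zeros-blockWord zero    a b = zeros-replicate-true-++ (a zero) []
zeros-blockWord (suc m) a b = begin
  zeros (blockWord (suc m) a b)                        ≡⟨ zeros-replicate-true-++ (a zero) _ ⟩
  zeros (replicate (b zero) false ++ rest)             ≡⟨ zeros-replicate-false-++ (b zero) rest ⟩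
  b zero + zeros rest                                  ≡⟨ cong (b zero +_) (zeros-blockWord m (a ∘ suc) (b ∘ suc)) ⟩
  foldr _+_ 0 b                                        ∎
  where rest = blockWord m (a ∘ suc) (b ∘ suc)

sumWhere-true+false : ∀ n I (b : Fin n → ℕ) → sumWhere n I true b + sumWhere n I false b ≡ foldr _+_ 0 b
sumWhere-true+false zero    I b = refl
sumWhere-true+false (suc m) I b with I zero
... | true  = trans (+-assoc (b zero) _ _) (cong (b zero +_) (sumWhere-true+false m (I ∘ suc) (b ∘ suc)))
... | false = trans (x∙yz≈y∙xz (sumWhere m (I ∘ suc) true (b ∘ suc)) (b zero) _)
                    (cong (b zero +_) (sumWhere-true+false m (I ∘ suc) (b ∘ suc)))

theorem1p2 : (n : ℕ) → 1 ≤ n → (a : Fin (suc n) → ℕ) → (b : Fin n → ℕ) →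
    (∀ i → 1 ≤ a i) → (∀ i → 1 ≤ b i) →
    ¬ (2 ∣ a zero) → ¬ (2 ∣ a (fromℕ n)) →
    (∀ (i : Fin (suc n)) → 1 ≤ toℕ i → toℕ i < n → 2 ∣ a i) →
    (∀ (I : Fin n → Bool) → sumWhere n I true b ≢ sumWhere n I false b) →
    ¬ IsShuffleSquare (blockWord n a b)
theorem1p2 n _ a b _ _ a₁-odd _ evens unbalanced (l , len , X≡Y)
  with zerosAtSplit-blockWord n a b evens l 0ℙ 1ℙ (λ _ → cong (ℙ._+ 1ℙ) (¬2∣⇒parity≡1ℙ a₁-odd)) len
... | I , split≡ = unbalanced I (sym (+-cancelˡ-≡ S S′ S (begin
  S + S′                  ≡⟨ sumWhere-true+false n I b ⟩
  foldr _+_ 0 b           ≡⟨ sym (zeros-blockWord n a b) ⟩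
  zeros W                 ≡⟨ sym (zerosAtSplit-shuffleSquare l W len X≡Y) ⟩
  split + split           ≡⟨ cong₂ _+_ split≡ split≡ ⟩
  S + S                   ∎)))
  where
  W = blockWord n a b
  split = zerosAtSplit l W 0ℙ 1ℙ
  S = sumWhere n I true b
  S′ = sumWhere n I false b
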